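{- Let $m$ be a positive integer. Then $m\leq\overset{\rightarrow}{\Gamma}_{LD}(K_m\Box K_m)\leq 3m\log(m+1)$.
   Context: $K_m\Box K_m$ is the Cartesian product of two complete graphs on $m$ vertices: vertices $(v_i,u_j)$, $1\leq i,j\leq m$, with $(v_{i_1},u_{j_1})$ adjacent to $(v_{i_2},u_{j_2})$ iff they are distinct and $i_1=i_2$ or $j_1=j_2$. Logarithms are base 2. For an orientation $D$ of a graph $G=(V,E)$, $S\subseteq V$ is locating-dominating in $D$ if every $u\notin S$ has an in-neighbour in $S$ and distinct $u,v\notin S$ have distinct sets of in-neighbours in $S$; $\gamma_{LD}(D)$ is the minimum size. $\overset{\rightarrow}{\Gamma}_{LD}(G)=\max_D\gamma_{LD}(D)$ over all orientations $D$ of $G$. -}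

module Defs where

open import Data.Nat using (ℕ; _+_; _≤_; _^_; _*_)
open import Data.Fin using (Fin)
open import Data.Bool using (Bool; true; false; if_then_else_)
open import Data.Product using (_×_; _,_; Σ)
open import Data.Sum using (_⊎_)
open import Data.Nat.ListAction using (sum)
open import Data.List using (List; map; cartesianProduct; allFin)
open import Relation.Binary.PropositionalEquality using (_≡_; _≢_)
open import Relation.Nullary using (¬_)

V : ℕ → Set
V m = Fin m × Fin m

Adj : {m : ℕ} → V m → V m → Set
Adj (i₁ , j₁) (i₂ , j₂) = (i₁ , j₁) ≢ (i₂ , j₂) × (i₁ ≡ i₂ ⊎ j₁ ≡ j₂)

record Orientation (m : ℕ) : Set where
  field
    arc     : V m → V m → Bool
    arc-adj : ∀ u v → arc u v ≡ true → Adj u v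
    total   : ∀ u v → Adj u v → arc u v ≡ true ⊎ arc v u ≡ true
    antisym : ∀ u v → arc u v ≡ true → arc v u ≡ false
open Orientation public

VSet : ℕ → Set
VSet m = V m → Bool

allV : (m : ℕ) → List (V m)
allV m = cartesianProduct (allFin m) (allFin m)

size : {m : ℕ} → VSet m → ℕ
size {m} S = sum (map (λ v → if S v then 1 else 0) (allV m))

IsLD : {m : ℕ} → Orientation m → VSet m → Set
IsLD {m} D S =
  (∀ (v : V m) → S v ≡ false → Σ (V m) λ u → S u ≡ true × arc D u v ≡ true)
  × (∀ (u v : V m) → S u ≡ false → S v ≡ false → u ≢ v →
       ¬ (∀ (w : V m) → S w ≡ true → arc D w u ≡ arc D w v))

-- Lower bound: in any orientation, if S misses a whole row i and a whole column j, then
-- (i , j) ∉ S has no in-neighbour in S, because all its neighbours lie in row i or column j.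
-- So S meets every row or every column, and |S| ≥ m.
--
-- Upper bound: each row and each column of K_m □ K_m induces a tournament, and a tournament
-- on n vertices has a dominating set D with 2^|D| ≤ n + 1: a vertex of maximum out-degree
-- beats at least half of the others, and one recurses on the vertices beating it. Let S
-- consist of, for every row, a dominating set R₁ of the row and a dominating set R₂ of the
-- rest of the row, and for every column a dominating set C. Two vertices outside S in one
-- row are separated by the in-neighbour of the first one in its column's C. Two vertices
-- u, v in different rows are separated because u has in-neighbours in both R₁ and R₂ of
-- its row, whereas at most one vertex of that row (the one in v's column) sends an arc to v.
-- Altogether 2^|S| ≤ ((m + 1)³)^m.
{-# OPTIONS --safe #-}
module Submission where

open import Data.Bool using (Bool; true; false; if_then_else_)
import Data.Bool as Bool
open import Data.Empty using (⊥-elim)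
open import Data.Fin using (Fin)
import Data.Fin.Properties as Finₚ
open import Data.List
  using (List; []; _∷_; length; map; filter; _++_; concat; concatMap; cartesianProduct; allFin)
open import Data.List.Membership.Propositional using (_∈_; _∉_)
open import Data.List.Membership.Propositional.Properties
  using (∈-map⁺; ∈-map⁻; ∈-allFin; ∈-++⁺ˡ; ∈-++⁺ʳ; ∈-concat⁺′; ∈-filter⁺; ∈-filter⁻)
open import Data.List.Properties
  using (map-++; map-∘; length-++; length-map; length-tabulate; length-filter)
open import Data.List.Relation.Binary.Subset.Propositional using (_⊆_)
open import Data.List.Relation.Unary.All.Properties using (All¬⇒¬Any)
open import Data.List.Relation.Unary.Any using (here; there)
open import Data.List.Relation.Unary.AllPairs using (_∷_)
open import Data.List.Relation.Unary.Unique.Propositional using (Unique)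
open import Data.List.Relation.Unary.Unique.Propositional.Properties
  using (map⁺; allFin⁺; cartesianProduct⁺; filter⁺)
open import Data.Nat using (ℕ; zero; suc; _+_; _*_; _^_; _≤_; _<_; z≤n; s≤s; _≤?_)
open import Data.Nat.Induction using (<-wellFounded)
open import Data.Nat.ListAction using (sum)
open import Data.Nat.ListAction.Properties using (sum-++)
open import Data.Nat.Properties
  using ( +-comm; +-suc; +-identityʳ; *-identityʳ; *-zeroʳ; *-suc; *-distribˡ-+; ^-distribˡ-+-*
        ; ^-*-assoc; m+n≡0⇒m≡0; m+n≡0⇒n≡0; ≤-refl; ≤-reflexive; ≤-trans; ≤-pred; <⇒≤; ≰⇒>
        ; m≤n+m; +-mono-≤; +-monoʳ-≤; *-mono-≤; *-monoʳ-≤; ^-monoʳ-≤; +-cancelˡ-≤; *-cancelˡ-≤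
        ; +-commutativeSemigroup; module ≤-Reasoning )
open import Algebra.Properties.CommutativeSemigroup +-commutativeSemigroup using (interchange)
open import Data.Product using (Σ; _×_; _,_; ∃-syntax; proj₁; proj₂)
open import Data.Product.Properties using (≡-dec)
open import Data.Sum using (_⊎_; inj₁; inj₂)
import Data.Sum as Sum
open import Function using (_∘_)
open import Induction.WellFounded using (Acc; acc)
open import Relation.Binary.Definitions using (DecidableEquality; tri<; tri≈; tri>)
open import Relation.Binary.PropositionalEquality
open import Relation.Nullary using (Dec; does; yes; no; ¬_)
open import Relation.Nullary.Decidable using (_×-dec_; _⊎-dec_; dec-true; dec-false)
open import Defs

ind : Bool → ℕ
ind b = if b then 1 else 0

ind≡0 : ∀ {b} → ind b ≡ 0 → b ≡ false
ind≡0 {false} _ = refl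

≡false⇒≢true : ∀ {b} → b ≡ false → b ≢ true
≡false⇒≢true refl ()

∑ : {A : Set} → (A → ℕ) → List A → ℕ
∑ f xs = sum (map f xs)

module _ {A : Set} where

  ∑-cong : ∀ {f g : A → ℕ} xs → (∀ {x} → x ∈ xs → f x ≡ g x) → ∑ f xs ≡ ∑ g xs
  ∑-cong []       f≡g = refl
  ∑-cong (x ∷ xs) f≡g = cong₂ _+_ (f≡g (here refl)) (∑-cong xs (f≡g ∘ there))

  ∑-mono : ∀ {f g : A → ℕ} xs → (∀ x → f x ≤ g x) → ∑ f xs ≤ ∑ g xs
  ∑-mono []       f≤g = z≤n
  ∑-mono (x ∷ xs) f≤g = +-mono-≤ (f≤g x) (∑-mono xs f≤g)

  ∑-+ : ∀ (f g : A → ℕ) xs → ∑ (λ x → f x + g x) xs ≡ ∑ f xs + ∑ g xs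
  ∑-+ f g []       = refl
  ∑-+ f g (x ∷ xs) = trans (cong (f x + g x +_) (∑-+ f g xs)) (interchange (f x) (g x) _ _)

  ∑-const : ∀ c (xs : List A) → ∑ (λ _ → c) xs ≡ length xs * c
  ∑-const c []       = refl
  ∑-const c (x ∷ xs) = cong (c +_) (∑-const c xs)

  ∑-++ : ∀ (f : A → ℕ) xs ys → ∑ f (xs ++ ys) ≡ ∑ f xs + ∑ f ys
  ∑-++ f xs ys = trans (cong sum (map-++ f xs ys)) (sum-++ (map f xs) (map f ys))

  ∑-map : ∀ {B : Set} (f : B → ℕ) (h : A → B) xs → ∑ f (map h xs) ≡ ∑ (f ∘ h) xs
  ∑-map f h xs = cong sum (sym (map-∘ xs))

  ∑≡0⇒≡0 : ∀ (f : A → ℕ) xs → ∑ f xs ≡ 0 → ∀ {x} → x ∈ xs → f x ≡ 0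
  ∑≡0⇒≡0 f (y ∷ xs) ∑≡0 (here refl) = m+n≡0⇒m≡0 (f y) ∑≡0
  ∑≡0⇒≡0 f (y ∷ xs) ∑≡0 (there x∈)  = ∑≡0⇒≡0 f xs (m+n≡0⇒n≡0 (f y) ∑≡0) x∈

  length≤∑⊎∃≡0 : ∀ (f : A → ℕ) xs → length xs ≤ ∑ f xs ⊎ ∃[ x ] x ∈ xs × f x ≡ 0
  length≤∑⊎∃≡0 f [] = inj₁ z≤n
  length≤∑⊎∃≡0 f (x ∷ xs) with f x in fx≡ | length≤∑⊎∃≡0 f xs
  ... | zero  | _                   = inj₂ (x , here refl , fx≡)
  ... | suc _ | inj₁ le             = inj₁ (s≤s (≤-trans le (m≤n+m _ _)))
  ... | suc _ | inj₂ (y , y∈ , fy≡) = inj₂ (y , there y∈ , fy≡)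

  ∑≤length*max : ∀ (f : A → ℕ) x xs → ∃[ v ] v ∈ x ∷ xs × ∑ f (x ∷ xs) ≤ length (x ∷ xs) * f v
  ∑≤length*max f x [] = x , here refl , ≤-refl
  ∑≤length*max f x (y ∷ ys) with ∑≤length*max f y ys
  ... | v , v∈ , ∑≤ with f x ≤? f v
  ...   | yes fx≤fv = v , there v∈ , +-mono-≤ fx≤fv ∑≤
  ...   | no  fx≰fv = x , here refl ,
          +-monoʳ-≤ (f x) (≤-trans ∑≤ (*-monoʳ-≤ (length (y ∷ ys)) (<⇒≤ (≰⇒> fx≰fv))))

∑-swap : ∀ {A B : Set} (g : A → B → ℕ) xs ys →
  ∑ (λ x → ∑ (g x) ys) xs ≡ ∑ (λ y → ∑ (λ x → g x y) xs) ys
∑-swap g []       ys = sym (trans (∑-const 0 ys) (*-zeroʳ (length ys)))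
∑-swap g (x ∷ xs) ys = trans (cong (∑ (g x) ys +_) (∑-swap g xs ys)) (sym (∑-+ (g x) _ ys))

∑-cartesianProduct : ∀ {A B : Set} (f : A × B → ℕ) xs ys →
  ∑ f (cartesianProduct xs ys) ≡ ∑ (λ x → ∑ (λ y → f (x , y)) ys) xs
∑-cartesianProduct f []       ys = refl
∑-cartesianProduct f (x ∷ xs) ys =
  trans (∑-++ f (map (x ,_) ys) (cartesianProduct xs ys))
        (cong₂ _+_ (∑-map f (x ,_) ys) (∑-cartesianProduct f xs ys))

length-filter-≡true : ∀ {A : Set} (f : A → Bool) xs →
  length (filter (λ x → f x Bool.≟ true) xs) ≡ ∑ (ind ∘ f) xs
length-filter-≡true f [] = refl
length-filter-≡true f (x ∷ xs) with f x
... | true  = cong suc (length-filter-≡true f xs)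
... | false = length-filter-≡true f xs

length-allFin : ∀ m → length (allFin m) ≡ m
length-allFin m = length-tabulate (λ i → i)

2^length-++≤ : ∀ {A : Set} {a b} (xs : List A) {ys} → 2 ^ length xs ≤ a → 2 ^ length ys ≤ b →
  2 ^ length (xs ++ ys) ≤ a * b
2^length-++≤ xs {ys} 2^xs≤ 2^ys≤ = begin
  2 ^ length (xs ++ ys)          ≡⟨ cong (2 ^_) (length-++ xs) ⟩
  2 ^ (length xs + length ys)    ≡⟨ ^-distribˡ-+-* 2 (length xs) (length ys) ⟩
  2 ^ length xs * 2 ^ length ys  ≤⟨ *-mono-≤ 2^xs≤ 2^ys≤ ⟩
  _                              ∎
  where open ≤-Reasoning

2^length-concat≤ : ∀ {A : Set} {c} (Bs : List (List A)) → (∀ {B} → B ∈ Bs → 2 ^ length B ≤ c) →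
  2 ^ length (concat Bs) ≤ c ^ length Bs
2^length-concat≤ []       _   = ≤-refl
2^length-concat≤ (B ∷ Bs) 2^≤ = 2^length-++≤ B (2^≤ (here refl)) (2^length-concat≤ Bs (2^≤ ∘ there))

2*[1+i]≤1+n : ∀ {n o i} → suc (o + i) ≡ n → n ≤ suc (o + o) → 2 * suc i ≤ suc n
2*[1+i]≤1+n {n} {o} {i} suc-o+i≡n n≤ = begin
  2 * suc i                ≡⟨ cong suc (trans (+-suc i (i + 0)) (cong (suc ∘ (i +_)) (+-identityʳ i))) ⟩
  suc (suc (i + i))        ≤⟨ s≤s (s≤s (+-monoʳ-≤ i i≤o)) ⟩
  suc (suc (i + o))        ≡⟨ cong (suc ∘ suc) (+-comm i o) ⟩
  suc (suc (o + i))        ≡⟨ cong suc suc-o+i≡n ⟩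
  suc n                    ∎
  where
  open ≤-Reasoning
  i≤o : i ≤ o
  i≤o = +-cancelˡ-≤ o i o (≤-pred (subst (_≤ suc (o + o)) (sym suc-o+i≡n) n≤))

module Counting {A : Set} (_≟_ : DecidableEquality A) where
  open import Data.List.Membership.DecPropositional _≟_ using (_∈?_)

  count : A → List A → ℕ
  count v = ∑ (λ w → ind (does (w ≟ v)))

  count-∉ : ∀ {v} U → v ∉ U → count v U ≡ 0
  count-∉     []      v∉ = refl
  count-∉ {v} (w ∷ U) v∉ with w ≟ v
  ... | yes refl = ⊥-elim (v∉ (here refl))
  ... | no  _    = count-∉ U (v∉ ∘ there)

  count-∈ : ∀ {v U} → Unique U → v ∈ U → count v U ≡ 1
  count-∈ {v} {w ∷ U} (w∉U ∷ uniq) v∈ with w ≟ v | v∈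
  ... | yes refl | _         = cong suc (count-∉ U (All¬⇒¬Any w∉U))
  ... | no  _    | there v∈U = count-∈ uniq v∈U
  ... | no  w≢v  | here v≡w  = ⊥-elim (w≢v (sym v≡w))

  count≤1 : ∀ {v U} → Unique U → count v U ≤ 1
  count≤1 {v} {U} uniq with v ∈? U
  ... | yes v∈ = ≤-reflexive (count-∈ uniq v∈)
  ... | no  v∉ = subst (_≤ 1) (sym (count-∉ U v∉)) z≤n

  ∑-∈?≤length : ∀ {U} → Unique U → ∀ M → ∑ (λ x → ind (does (x ∈? M))) U ≤ length M
  ∑-∈?≤length {U} uniq []      = ≤-reflexive (trans (∑-const 0 U) (*-zeroʳ (length U)))
  ∑-∈?≤length {U} uniq (l ∷ M) = begin
      ∑ (λ x → ind (does (x ∈? l ∷ M))) U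
    ≤⟨ ∑-mono U ind-∈?-∷ ⟩
      ∑ (λ x → ind (does (x ≟ l)) + ind (does (x ∈? M))) U
    ≡⟨ ∑-+ _ _ U ⟩
      count l U + ∑ (λ x → ind (does (x ∈? M))) U
    ≤⟨ +-mono-≤ (count≤1 uniq) (∑-∈?≤length uniq M) ⟩
      suc (length M) ∎
    where
    open ≤-Reasoning
    ind-∈?-∷ : ∀ x → ind (does (x ∈? l ∷ M)) ≤ ind (does (x ≟ l)) + ind (does (x ∈? M))
    ind-∈?-∷ x with x ≟ l
    ... | yes _ = s≤s z≤n
    ... | no  _ = ≤-refl

module Tournament {A : Set} (_≟_ : DecidableEquality A) (t : A → A → Bool)
                  (t-asym : ∀ {x y} → t x y ≡ true → t y x ≡ false) where
  open Counting _≟_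

  _⟶_ : A → A → Set
  x ⟶ y = t x y ≡ true

  _⟶?_ : ∀ x y → Dec (x ⟶ y)
  x ⟶? y = t x y Bool.≟ true

  t-irrefl : ∀ x → t x x ≡ false
  t-irrefl x with t x x in txx
  ... | true  = trans (sym txx) (t-asym txx)
  ... | false = refl

  IsTournament : List A → Set
  IsTournament U = ∀ {x y} → x ∈ U → y ∈ U → x ≢ y → x ⟶ y ⊎ y ⟶ x

  IsTournament-⊆ : ∀ {U W} → W ⊆ U → IsTournament U → IsTournament W
  IsTournament-⊆ W⊆U tour x∈ y∈ = tour (W⊆U x∈) (W⊆U y∈)

  outdeg indeg : A → List A → ℕ
  outdeg v = ∑ (λ w → ind (t v w))
  indeg  v = ∑ (λ w → ind (t w v))

  inNeighbours : A → List A → List A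
  inNeighbours v = filter (_⟶? v)

  outdeg+indeg : ∀ {U v} → Unique U → IsTournament U → v ∈ U →
    suc (outdeg v U + indeg v U) ≡ length U
  outdeg+indeg {U} {v} uniq tour v∈ = begin
      suc (outdeg v U + indeg v U)
    ≡⟨ +-comm 1 _ ⟩
      outdeg v U + indeg v U + 1
    ≡⟨ cong₂ _+_ (∑-+ _ _ U) (count-∈ uniq v∈) ⟨
      ∑ (λ w → ind (t v w) + ind (t w v)) U + count v U
    ≡⟨ ∑-+ _ _ U ⟨
      ∑ (λ w → ind (t v w) + ind (t w v) + ind (does (w ≟ v))) U
    ≡⟨ ∑-cong U exactly-one ⟩
      ∑ (λ _ → 1) U
    ≡⟨ trans (∑-const 1 U) (*-identityʳ _) ⟩
      length U ∎
    where
    open ≡-Reasoning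
    exactly-one : ∀ {w} → w ∈ U → ind (t v w) + ind (t w v) + ind (does (w ≟ v)) ≡ 1
    exactly-one {w} w∈ with w ≟ v
    ... | yes refl rewrite t-irrefl w = refl
    ... | no  w≢v with tour v∈ w∈ (w≢v ∘ sym)
    ...   | inj₁ v⟶w rewrite v⟶w | t-asym v⟶w = refl
    ...   | inj₂ w⟶v rewrite w⟶v | t-asym w⟶v = refl

  ∃-outdeg≥half : ∀ {x xs} → Unique (x ∷ xs) → IsTournament (x ∷ xs) →
    ∃[ v ] v ∈ x ∷ xs × length (x ∷ xs) ≤ suc (outdeg v (x ∷ xs) + outdeg v (x ∷ xs))
  ∃-outdeg≥half {x} {xs} uniq tour with ∑≤length*max (λ v → outdeg v (x ∷ xs)) x xs
  ... | v , v∈ , ∑≤ = v , v∈ , *-cancelˡ-≤ n n*n≤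
    where
    U = x ∷ xs
    n = length U
    o = outdeg v U
    ∑out = ∑ (λ w → outdeg w U) U
    ∑indeg≡∑outdeg : ∑ (λ w → indeg w U) U ≡ ∑out
    ∑indeg≡∑outdeg = sym (∑-swap (λ a b → ind (t a b)) U U)
    n*n≤ : n * n ≤ n * suc (o + o)
    n*n≤ = begin
        n * n
      ≡⟨ trans (∑-cong U (outdeg+indeg uniq tour)) (∑-const n U) ⟨
        ∑ (λ w → 1 + (outdeg w U + indeg w U)) U
      ≡⟨ ∑-+ (λ _ → 1) _ U ⟩
        ∑ (λ _ → 1) U + ∑ (λ w → outdeg w U + indeg w U) U
      ≡⟨ cong₂ _+_ (trans (∑-const 1 U) (*-identityʳ n)) (∑-+ (λ w → outdeg w U) (λ w → indeg w U) U) ⟩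
        n + (∑out + ∑ (λ w → indeg w U) U)
      ≡⟨ cong (λ s → n + (∑out + s)) ∑indeg≡∑outdeg ⟩
        n + (∑out + ∑out)
      ≤⟨ +-monoʳ-≤ n (+-mono-≤ ∑≤ ∑≤) ⟩
        n + (n * o + n * o)
      ≡⟨ trans (*-suc n (o + o)) (cong (n +_) (*-distribˡ-+ n o o)) ⟨
        n * suc (o + o) ∎
      where open ≤-Reasoning

  record DominatingSet (U : List A) : Set where
    field
      members           : List A
      members⊆          : members ⊆ U
      2^|members|≤1+|U| : 2 ^ length members ≤ suc (length U)
      dominates         : ∀ {x} → x ∈ U → x ∈ members ⊎ ∃[ y ] y ∈ members × y ⟶ x
  open DominatingSet

  dominatingSet-acc : ∀ U → Acc _<_ (length U) → Unique U → IsTournament U → DominatingSet U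
  dominatingSet-acc [] _ _ _ = record
    { members = [] ; members⊆ = λ () ; 2^|members|≤1+|U| = ≤-refl ; dominates = λ () }
  dominatingSet-acc U@(x ∷ xs) (acc rec) uniq tour with ∃-outdeg≥half uniq tour
  ... | v , v∈U , n≤ = record
    { members           = v ∷ members D′
    ; members⊆          = λ { (here refl) → v∈U
                            ; (there y∈) → proj₁ (∈-filter⁻ (_⟶? v) (members⊆ D′ y∈)) }
    ; 2^|members|≤1+|U| = ≤-trans (*-monoʳ-≤ 2 (2^|members|≤1+|U| D′))
                            (subst (λ k → 2 * suc k ≤ suc (length U)) (sym |U′|≡i)
                              (2*[1+i]≤1+n {o = o} suc-o+i≡n n≤))
    ; dominates         = dominated
    }
    where
    o = outdeg v U
    i = indeg v U
    U′ = inNeighbours v U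
    suc-o+i≡n : suc (o + i) ≡ length U
    suc-o+i≡n = outdeg+indeg uniq tour v∈U
    |U′|≡i : length U′ ≡ i
    |U′|≡i = length-filter-≡true (λ w → t w v) U
    D′ : DominatingSet U′
    D′ = dominatingSet-acc U′ (rec (subst₂ _<_ (sym |U′|≡i) suc-o+i≡n (s≤s (m≤n+m i o))))
           (filter⁺ (_⟶? v) uniq) (IsTournament-⊆ (proj₁ ∘ ∈-filter⁻ (_⟶? v)) tour)
    dominated : ∀ {y} → y ∈ U → y ∈ v ∷ members D′ ⊎ ∃[ z ] z ∈ v ∷ members D′ × z ⟶ y
    dominated {y} y∈U with y ≟ v
    ... | yes refl = inj₁ (here refl)
    ... | no y≢v with tour y∈U v∈U y≢v
    ...   | inj₂ v⟶y = inj₂ (v , here refl , v⟶y)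
    ...   | inj₁ y⟶v with dominates D′ (∈-filter⁺ (_⟶? v) y∈U y⟶v)
    ...     | inj₁ y∈D′            = inj₁ (there y∈D′)
    ...     | inj₂ (z , z∈D′ , z⟶y) = inj₂ (z , there z∈D′ , z⟶y)

  dominatingSet : ∀ U → Unique U → IsTournament U → DominatingSet U
  dominatingSet U = dominatingSet-acc U (<-wellFounded (length U))

module LowerBound {m : ℕ} (D : Orientation m) (S : VSet m) where

  rowCount colCount : Fin m → ℕ
  rowCount i = ∑ (λ j → ind (S (i , j))) (allFin m)
  colCount j = ∑ (λ i → ind (S (i , j))) (allFin m)

  size≡∑rowCount : size S ≡ ∑ rowCount (allFin m)
  size≡∑rowCount = ∑-cartesianProduct (ind ∘ S) (allFin m) (allFin m)

  size≡∑colCount : size S ≡ ∑ colCount (allFin m)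
  size≡∑colCount = trans size≡∑rowCount (∑-swap (λ i j → ind (S (i , j))) (allFin m) (allFin m))

  row-avoids : ∀ {i} → rowCount i ≡ 0 → ∀ j → S (i , j) ≡ false
  row-avoids row≡0 j = ind≡0 (∑≡0⇒≡0 _ (allFin m) row≡0 (∈-allFin j))

  col-avoids : ∀ {j} → colCount j ≡ 0 → ∀ i → S (i , j) ≡ false
  col-avoids col≡0 i = ind≡0 (∑≡0⇒≡0 _ (allFin m) col≡0 (∈-allFin i))

  undominated : ∀ {i j} → rowCount i ≡ 0 → colCount j ≡ 0 →
    ¬ (∃[ u ] S u ≡ true × arc D u (i , j) ≡ true)
  undominated row≡0 col≡0 ((k , l) , Su , u⟶) with arc-adj D (k , l) _ u⟶
  ... | _ , inj₁ refl = ≡false⇒≢true (row-avoids row≡0 l) Su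
  ... | _ , inj₂ refl = ≡false⇒≢true (col-avoids col≡0 k) Su

  m≤size : IsLD D S → m ≤ size S
  m≤size (dominating , _)
    with length≤∑⊎∃≡0 rowCount (allFin m) | length≤∑⊎∃≡0 colCount (allFin m)
  ... | inj₁ m≤∑ | _ = subst₂ _≤_ (length-allFin m) (sym size≡∑rowCount) m≤∑
  ... | _ | inj₁ m≤∑ = subst₂ _≤_ (length-allFin m) (sym size≡∑colCount) m≤∑
  ... | inj₂ (i , _ , row≡0) | inj₂ (j , _ , col≡0) =
    ⊥-elim (undominated row≡0 col≡0 (dominating (i , j) (row-avoids row≡0 j)))

module RowColumnOrder (m : ℕ) where
  open import Data.Fin using () renaming (_<_ to _<ᶠ_)

  _⇀_ : V m → V m → Set
  (i₁ , j₁) ⇀ (i₂ , j₂) = (i₁ ≡ i₂ × j₁ <ᶠ j₂) ⊎ (j₁ ≡ j₂ × i₁ <ᶠ i₂)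

  _⇀?_ : ∀ u v → Dec (u ⇀ v)
  (i₁ , j₁) ⇀? (i₂ , j₂) =
    (i₁ Finₚ.≟ i₂ ×-dec j₁ Finₚ.<? j₂) ⊎-dec (j₁ Finₚ.≟ j₂ ×-dec i₁ Finₚ.<? i₂)

  ⇀⇒Adj : ∀ {u v} → u ⇀ v → Adj u v
  ⇀⇒Adj (inj₁ (refl , j₁<j₂)) = Finₚ.<⇒≢ j₁<j₂ ∘ cong proj₂ , inj₁ refl
  ⇀⇒Adj (inj₂ (refl , i₁<i₂)) = Finₚ.<⇒≢ i₁<i₂ ∘ cong proj₁ , inj₂ refl

  ⇀-asym : ∀ {u v} → u ⇀ v → ¬ v ⇀ u
  ⇀-asym (inj₁ (_ , j₁<j₂)) (inj₁ (_ , j₂<j₁)) = Finₚ.<-asym j₁<j₂ j₂<j₁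
  ⇀-asym (inj₁ (_ , j₁<j₂)) (inj₂ (j₂≡j₁ , _)) = Finₚ.<⇒≢ j₁<j₂ (sym j₂≡j₁)
  ⇀-asym (inj₂ (_ , i₁<i₂)) (inj₁ (i₂≡i₁ , _)) = Finₚ.<⇒≢ i₁<i₂ (sym i₂≡i₁)
  ⇀-asym (inj₂ (_ , i₁<i₂)) (inj₂ (_ , i₂<i₁)) = Finₚ.<-asym i₁<i₂ i₂<i₁

  ⇀-total : ∀ {u v} → Adj u v → u ⇀ v ⊎ v ⇀ u
  ⇀-total {i₁ , j₁} {i₂ , j₂} (u≢v , inj₁ refl) with Finₚ.<-cmp j₁ j₂
  ... | tri< j₁<j₂ _ _ = inj₁ (inj₁ (refl , j₁<j₂))
  ... | tri≈ _ refl _  = ⊥-elim (u≢v refl)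
  ... | tri> _ _ j₂<j₁ = inj₂ (inj₁ (refl , j₂<j₁))
  ⇀-total {i₁ , j₁} {i₂ , j₂} (u≢v , inj₂ refl) with Finₚ.<-cmp i₁ i₂
  ... | tri< i₁<i₂ _ _ = inj₁ (inj₂ (refl , i₁<i₂))
  ... | tri≈ _ refl _  = ⊥-elim (u≢v refl)
  ... | tri> _ _ i₂<i₁ = inj₂ (inj₂ (refl , i₂<i₁))

  witness : ∀ {P : Set} (p? : Dec P) → does p? ≡ true → P
  witness (yes p) _ = p

  rowColumnOrientation : Orientation m
  rowColumnOrientation = record
    { arc     = λ u v → does (u ⇀? v)
    ; arc-adj = λ u v u⇀v → ⇀⇒Adj (witness (u ⇀? v) u⇀v)
    ; total   = λ u v adj → Sum.map (dec-true (u ⇀? v)) (dec-true (v ⇀? u)) (⇀-total adj)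
    ; antisym = λ u v u⇀v → dec-false (v ⇀? u) (⇀-asym (witness (u ⇀? v) u⇀v))
    }

module UpperBound {m : ℕ} (D : Orientation m) where

  _≟_ : DecidableEquality (V m)
  _≟_ = ≡-dec Finₚ._≟_ Finₚ._≟_

  open import Data.List.Membership.DecPropositional _≟_ using (_∈?_; _∉?_)
  open Counting _≟_
  open Tournament _≟_ (arc D) (antisym D _ _)
  open DominatingSet

  row col : Fin m → List (V m)
  row i = map (i ,_) (allFin m)
  col j = map (_, j) (allFin m)

  ∈-row⁻ : ∀ {i x} → x ∈ row i → proj₁ x ≡ i
  ∈-row⁻ {i} x∈ with ∈-map⁻ (i ,_) x∈
  ... | _ , _ , refl = refl

  ∈-col⁻ : ∀ {j x} → x ∈ col j → proj₂ x ≡ j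
  ∈-col⁻ {j} x∈ with ∈-map⁻ (_, j) x∈
  ... | _ , _ , refl = refl

  ∈-row⁺ : ∀ i j → (i , j) ∈ row i
  ∈-row⁺ i j = ∈-map⁺ (i ,_) (∈-allFin j)

  ∈-col⁺ : ∀ i j → (i , j) ∈ col j
  ∈-col⁺ i j = ∈-map⁺ (_, j) (∈-allFin i)

  row-tournament : ∀ i → IsTournament (row i)
  row-tournament i x∈ y∈ x≢y = total D _ _ (x≢y , inj₁ (trans (∈-row⁻ x∈) (sym (∈-row⁻ y∈))))

  col-tournament : ∀ j → IsTournament (col j)
  col-tournament j x∈ y∈ x≢y = total D _ _ (x≢y , inj₂ (trans (∈-col⁻ x∈) (sym (∈-col⁻ y∈))))

  length-row : ∀ i → length (row i) ≡ m
  length-row i = trans (length-map (i ,_) (allFin m)) (length-allFin m)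

  length-col : ∀ j → length (col j) ≡ m
  length-col j = trans (length-map (_, j) (allFin m)) (length-allFin m)

  R₁ : ∀ i → DominatingSet (row i)
  R₁ i = dominatingSet (row i) (map⁺ (cong proj₂) (allFin⁺ m)) (row-tournament i)

  row∖R₁ : Fin m → List (V m)
  row∖R₁ i = filter (_∉? members (R₁ i)) (row i)

  ∈-row∖R₁⁻ : ∀ {i x} → x ∈ row∖R₁ i → x ∈ row i × x ∉ members (R₁ i)
  ∈-row∖R₁⁻ {i} = ∈-filter⁻ (_∉? members (R₁ i)) {xs = row i}

  R₂ : ∀ i → DominatingSet (row∖R₁ i)
  R₂ i = dominatingSet (row∖R₁ i) (filter⁺ (_∉? members (R₁ i)) (map⁺ (cong proj₂) (allFin⁺ m)))
           (IsTournament-⊆ (proj₁ ∘ ∈-row∖R₁⁻) (row-tournament i))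

  C : ∀ j → DominatingSet (col j)
  C j = dominatingSet (col j) (map⁺ (cong proj₁) (allFin⁺ m)) (col-tournament j)

  block : Fin m → List (V m)
  block i = members (R₁ i) ++ members (R₂ i) ++ members (C i)

  L : List (V m)
  L = concatMap block (allFin m)

  S : VSet m
  S v = does (v ∈? L)

  ∈-block⇒S : ∀ {i x} → x ∈ block i → S x ≡ true
  ∈-block⇒S {i} x∈ = dec-true (_ ∈? L) (∈-concat⁺′ x∈ (∈-map⁺ block (∈-allFin i)))

  ∈R₁⇒S : ∀ {i x} → x ∈ members (R₁ i) → S x ≡ true
  ∈R₁⇒S = ∈-block⇒S ∘ ∈-++⁺ˡ

  ∈R₂⇒S : ∀ {i x} → x ∈ members (R₂ i) → S x ≡ true
  ∈R₂⇒S {i} = ∈-block⇒S ∘ ∈-++⁺ʳ (members (R₁ i)) ∘ ∈-++⁺ˡ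

  ∈C⇒S : ∀ {j x} → x ∈ members (C j) → S x ≡ true
  ∈C⇒S {j} = ∈-block⇒S ∘ ∈-++⁺ʳ (members (R₁ j)) ∘ ∈-++⁺ʳ (members (R₂ j))

  arc-within-col : ∀ {u v} → u ⟶ v → proj₁ u ≢ proj₁ v → proj₂ u ≡ proj₂ v
  arc-within-col u⟶v i≢ with arc-adj D _ _ u⟶v
  ... | _ , inj₁ i≡ = ⊥-elim (i≢ i≡)
  ... | _ , inj₂ j≡ = j≡

  arc-within-row : ∀ {u v} → u ⟶ v → proj₂ u ≢ proj₂ v → proj₁ u ≡ proj₁ v
  arc-within-row u⟶v j≢ with arc-adj D _ _ u⟶v
  ... | _ , inj₁ i≡ = i≡
  ... | _ , inj₂ j≡ = ⊥-elim (j≢ j≡)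

  dominating : ∀ v → S v ≡ false → ∃[ u ] S u ≡ true × u ⟶ v
  dominating (i , j) Sv≡false with dominates (R₁ i) (∈-row⁺ i j)
  ... | inj₁ v∈R₁            = ⊥-elim (≡false⇒≢true Sv≡false (∈R₁⇒S v∈R₁))
  ... | inj₂ (u , u∈R₁ , u⟶v) = u , ∈R₁⇒S u∈R₁ , u⟶v

  SameInNeighbours : V m → V m → Set
  SameInNeighbours u v = ∀ w → S w ≡ true → arc D w u ≡ arc D w v

  same-row-separated : ∀ {i j₁ j₂} → S (i , j₁) ≡ false → j₁ ≢ j₂ →
    ¬ SameInNeighbours (i , j₁) (i , j₂)
  same-row-separated {i} {j₁} Su≡false j₁≢j₂ same with dominates (C j₁) (∈-col⁺ i j₁)
  ... | inj₁ u∈C = ≡false⇒≢true Su≡false (∈C⇒S u∈C)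
  ... | inj₂ (w , w∈C , w⟶u) with ∈-col⁻ (members⊆ (C j₁) w∈C)
  ...   | refl = proj₁ (arc-adj D _ _ w⟶u) (cong (_, j₁) (arc-within-row w⟶v j₁≢j₂))
    where w⟶v = trans (sym (same w (∈C⇒S w∈C))) w⟶u

  different-rows-separated : ∀ {i₁ j₁ v} → S (i₁ , j₁) ≡ false → i₁ ≢ proj₁ v →
    ¬ SameInNeighbours (i₁ , j₁) v
  different-rows-separated {i₁} {j₁} {v} Su≡false i₁≢ same
    with dominates (R₁ i₁) (∈-row⁺ i₁ j₁)
       | dominates (R₂ i₁) (∈-filter⁺ (_∉? members (R₁ i₁)) (∈-row⁺ i₁ j₁) u∉R₁)
    where u∉R₁ = ≡false⇒≢true Su≡false ∘ ∈R₁⇒S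
  ... | inj₁ u∈R₁ | _ = ≡false⇒≢true Su≡false (∈R₁⇒S u∈R₁)
  ... | _ | inj₁ u∈R₂ = ≡false⇒≢true Su≡false (∈R₂⇒S u∈R₂)
  ... | inj₂ (a , a∈R₁ , a⟶u) | inj₂ (b , b∈R₂ , b⟶u) = b∉R₁ (subst (_∈ members (R₁ i₁)) a≡b a∈R₁)
    where
    b∉R₁ = proj₂ (∈-row∖R₁⁻ (members⊆ (R₂ i₁) b∈R₂))
    a∈row = ∈-row⁻ (members⊆ (R₁ i₁) a∈R₁)
    b∈row = ∈-row⁻ (proj₁ (∈-row∖R₁⁻ (members⊆ (R₂ i₁) b∈R₂)))
    a⟶v = trans (sym (same a (∈R₁⇒S a∈R₁))) a⟶u
    b⟶v = trans (sym (same b (∈R₂⇒S b∈R₂))) b⟶u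
    a≡b : a ≡ b
    a≡b = cong₂ _,_ (trans a∈row (sym b∈row))
      (trans (arc-within-col a⟶v (i₁≢ ∘ trans (sym a∈row)))
        (sym (arc-within-col b⟶v (i₁≢ ∘ trans (sym b∈row)))))

  isLD : IsLD D S
  isLD = dominating , locating
    where
    locating : ∀ u v → S u ≡ false → S v ≡ false → u ≢ v → ¬ SameInNeighbours u v
    locating (i₁ , j₁) (i₂ , j₂) Su≡false _ u≢v with i₁ Finₚ.≟ i₂
    ... | yes refl = same-row-separated Su≡false (u≢v ∘ cong (i₁ ,_))
    ... | no  i₁≢i₂ = different-rows-separated Su≡false i₁≢i₂

  size≤length : size S ≤ length L
  size≤length = ∑-∈?≤length (cartesianProduct⁺ (allFin⁺ m) (allFin⁺ m)) L

  2^length-block≤ : ∀ i → 2 ^ length (block i) ≤ suc m ^ 3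
  2^length-block≤ i =
    subst (2 ^ length (block i) ≤_) (cong (λ k → suc m * (suc m * k)) (sym (*-identityʳ (suc m))))
      (2^length-++≤ (members (R₁ i)) R₁≤ (2^length-++≤ (members (R₂ i)) R₂≤ C≤))
    where
    R₁≤ : 2 ^ length (members (R₁ i)) ≤ suc m
    R₁≤ = ≤-trans (2^|members|≤1+|U| (R₁ i)) (≤-reflexive (cong suc (length-row i)))
    R₂≤ : 2 ^ length (members (R₂ i)) ≤ suc m
    R₂≤ = ≤-trans (2^|members|≤1+|U| (R₂ i))
      (s≤s (subst (length (row∖R₁ i) ≤_) (length-row i) (length-filter (_∉? members (R₁ i)) (row i))))
    C≤ : 2 ^ length (members (C i)) ≤ suc m
    C≤ = ≤-trans (2^|members|≤1+|U| (C i)) (≤-reflexive (cong suc (length-col i)))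

  2^size≤ : 2 ^ size S ≤ (m + 1) ^ (3 * m)
  2^size≤ = begin
      2 ^ size S
    ≤⟨ ^-monoʳ-≤ 2 size≤length ⟩
      2 ^ length (concat (map block (allFin m)))
    ≤⟨ 2^length-concat≤ (map block (allFin m)) block≤ ⟩
      (suc m ^ 3) ^ length (map block (allFin m))
    ≡⟨ cong ((suc m ^ 3) ^_) (trans (length-map block (allFin m)) (length-allFin m)) ⟩
      (suc m ^ 3) ^ m
    ≡⟨ ^-*-assoc (suc m) 3 m ⟩
      suc m ^ (3 * m)
    ≡⟨ cong (_^ (3 * m)) (+-comm 1 m) ⟩
      (m + 1) ^ (3 * m) ∎
    where
    open ≤-Reasoning
    block≤ : ∀ {B} → B ∈ map block (allFin m) → 2 ^ length B ≤ suc m ^ 3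
    block≤ B∈ with ∈-map⁻ block B∈
    ... | i , _ , refl = 2^length-block≤ i

theorem42 : (m : ℕ) → 1 ≤ m →
    (Σ (Orientation m) λ D → ∀ (S : VSet m) → IsLD D S → m ≤ size S)
    × (∀ (D : Orientation m) → Σ (VSet m) λ S → IsLD D S × 2 ^ size S ≤ (m + 1) ^ (3 * m))
theorem42 m _ =
  (rowColumnOrientation , LowerBound.m≤size rowColumnOrientation) ,
  λ D → UpperBound.S D , UpperBound.isLD D , UpperBound.2^size≤ D
  where open RowColumnOrder m
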